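{- The set of $\mathcal{P}$-positions of $\mathcal{E}$-Wythoff equals the set of $\mathcal{P}$-positions of Wythoff's game, namely $\{(\lfloor \phi n\rfloor, \lfloor \phi n\rfloor + n) : n \geq 0\}$ (positions being unordered), where $\phi = (1+\sqrt{5})/2$.
   Context: A position is an unordered pair $(a,b)$ of nonnegative integers (pile sizes). Two players alternate; the player making the last move wins. In Wythoff's game a move either removes a positive number of tokens from one pile, or removes the same positive number of tokens from both piles. $\mathcal{E}$-Wythoff is the extension of Wythoff's game obtained by additionally allowing the move that removes $k$ tokens from the smaller pile (or from either pile if the piles are equal) and $l$ tokens from the other pile, for any integers $k \geq 1$, $l \geq 0$ with $l < k$. A $\mathcal{P}$-position is a position from which the player about to move cannot force a win. -}

module Defs where

open import Data.Nat using (ℕ; zero; suc; _+_; _*_; _∸_; _^_; _≤_; _<_)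
open import Data.Product using (_×_; _,_; ∃-syntax)
open import Data.Sum using (_⊎_)
open import Relation.Binary.PropositionalEquality using (_≡_)

-- Positions are unordered: every move
-- relation below is symmetric under swapping the two piles, so the ordered
-- pairs (a , b) and (b , a) represent the same position.
Pos : Set
Pos = ℕ × ℕ

data WMove : Pos → Pos → Set where
  takeL : ∀ {a b k} → WMove (a + suc k , b) (a , b)
  takeR : ∀ {a b k} → WMove (a , b + suc k) (a , b)
  takeB : ∀ {a b k} → WMove (a + suc k , b + suc k) (a , b)

-- E-Wythoff moves: Wythoff moves plus removing k from the smaller pile
-- (either pile if equal) and l from the other, with 0 ≤ l < k (so k ≥ 1).
data EMove : Pos → Pos → Set where
  wyt    : ∀ {p q} → WMove p q → EMove p q
  extraL : ∀ {a b k l} → l < k → a + k ≤ b + l → EMove (a + k , b + l) (a , b)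
  extraR : ∀ {a b k l} → l < k → b + k ≤ a + l → EMove (a + l , b + k) (a , b)

-- Normal play: P p  = the player to move from p cannot force a win
--              N p  = the player to move from p can force a win.
-- (All games here are finite, so this inductive characterisation is exact.)
mutual
  data P (Move : Pos → Pos → Set) (p : Pos) : Set where
    allToN : (∀ q → Move p q → N Move q) → P Move p

  data N (Move : Pos → Pos → Set) (p : Pos) : Set where
    toP : ∀ q → Move p q → P Move q → N Move p

-- IsFloorPhiMul n a  ⇔  a = ⌊ φ n ⌋ , φ = (1 + √5)/2.
-- a ≤ φ n      ⇔  2a - n ≤ √5 n   ⇔  (2a ∸ n)² ≤ 5 n²
-- φ n < a + 1  ⇔  √5 n < 2(a+1) - n ⇔ 5 n² < (2(a+1) ∸ n)²
IsFloorPhiMul : ℕ → ℕ → Set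
IsFloorPhiMul n a =
  ((2 * a ∸ n) ^ 2 ≤ 5 * n ^ 2) × (5 * n ^ 2 < (2 * suc a ∸ n) ^ 2)

WythoffSet : Pos → Set
WythoffSet (a , b) =
  ∃[ n ] ∃[ m ] (IsFloorPhiMul n m ×
     ((a ≡ m × b ≡ m + n) ⊎ (b ≡ m × a ≡ m + n)))

{-# OPTIONS --safe #-}

-- The pairs (⌊φ n⌋ , ⌊φ n⌋ + n) form a kernel of the E-Wythoff move graph: every position
-- outside it has a Wythoff move into it, and no E-Wythoff move joins two of its members.
-- The latter rests on the complementarity of the Beatty sequences ⌊φ n⌋ and ⌊φ n⌋ + n = ⌊φ² n⌋
-- (each positive integer is a pile of exactly one pair), on the differences n being distinct,
-- and on ⌊φ n⌋ being increasing, which defeats the extra moves: they enlarge the difference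
-- while shrinking the smaller pile. In a terminating game the P-positions are exactly such a
-- kernel, for Wythoff's game and for E-Wythoff alike.
module Submission where

open import Defs
open import Data.Empty using (⊥; ⊥-elim)
open import Data.List using (_∷_; [])
open import Data.Nat
open import Data.Nat.Induction using (<-wellFounded)
open import Data.Nat.Properties
open import Data.Nat.Tactic.RingSolver using (solve)
open import Data.Product using (_×_; _,_; ∃-syntax; swap)
open import Data.Sum using (_⊎_; inj₁; inj₂)
import Data.Sum as Sum
open import Function.Bundles using (_⇔_; mk⇔; Equivalence)
open import Function.Construct.Composition using (_⇔-∘_)
open import Function.Construct.Symmetry using (⇔-sym)
open import Induction.WellFounded using (Acc; acc)
open import Relation.Nullary using (¬_; Dec; yes; no)
open import Relation.Nullary.Decidable using (map′)
open import Relation.Unary using (Decidable)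
open import Relation.Binary.Definitions using (tri<; tri≈; tri>)
open import Relation.Binary.PropositionalEquality

open Equivalence using (to; from)

private
  variable
    a b c d k l m m′ n n′ t x x′ y y′ : ℕ
    p q : Pos

-- Since φ is the positive root of t² = t + 1, for natural numbers x ≤ φ y holds iff x² ≤ x y + y².
infix 4 _≤φ_ _<φ_ φ_<_

data _≤φ_ (x y : ℕ) : Set where
  mk≤φ : x * x ≤ x * y + y * y → x ≤φ y

data _<φ_ (x y : ℕ) : Set where
  mk<φ : x * x < x * y + y * y → x <φ y

data φ_<_ (y x : ℕ) : Set where
  mkφ< : x * y + y * y < x * x → φ y < x

<φ⇒≤φ : x <φ y → x ≤φ y
<φ⇒≤φ (mk<φ lt) = mk≤φ (<⇒≤ lt)

≤φ⇒¬φ< : x ≤φ y → ¬ φ y < x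
≤φ⇒¬φ< (mk≤φ le) (mkφ< lt) = <⇒≱ lt le

¬φ<⇒≤φ : ¬ φ y < x → x ≤φ y
¬φ<⇒≤φ ¬lt = mk≤φ (≮⇒≥ (λ lt → ¬lt (mkφ< lt)))

φ_<?_ : ∀ y x → Dec (φ y < x)
φ y <? x = map′ mkφ< (λ { (mkφ< lt) → lt }) (x * y + y * y <? x * x)

≤⇒≤φ : x ≤ y → x ≤φ y
≤⇒≤φ {x} {y} x≤y = mk≤φ (≤-trans (*-monoʳ-≤ x x≤y) (m≤m+n (x * y) (y * y)))

φ<⇒> : φ y < x → y < x
φ<⇒> φy<x = ≰⇒> (λ x≤y → ≤φ⇒¬φ< (≤⇒≤φ x≤y) φy<x)

φ<-≤-trans : φ y < x → x ≤ x′ → φ y < x′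
φ<-≤-trans {y} {x} {x′} φy<x@(mkφ< lt) x≤x′ with m≤n⇒∃[o]m+o≡n x≤x′
... | d , refl = mkφ< (begin-strict
  (x + d) * y + y * y       ≡⟨ solve (x ∷ y ∷ d ∷ []) ⟩
  (x * y + y * y) + d * y   <⟨ +-monoˡ-< (d * y) lt ⟩
  x * x + d * y             ≤⟨ +-monoʳ-≤ (x * x) (≤-trans dy≤dx (m≤m+n (d * x) (x * d + d * d))) ⟩
  x * x + (d * x + (x * d + d * d)) ≡⟨ solve (x ∷ d ∷ []) ⟩
  (x + d) * (x + d)         ∎)
  where
  open ≤-Reasoning
  dy≤dx : d * y ≤ d * x
  dy≤dx = *-monoʳ-≤ d (<⇒≤ (φ<⇒> φy<x))

<φ-φ<-trans : x <φ y → φ y < x′ → x < x′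
<φ-φ<-trans x<φy φy<x′ =
  ≰⇒> (λ x′≤x → ≤φ⇒¬φ< (<φ⇒≤φ x<φy) (φ<-≤-trans φy<x′ x′≤x))

<φ⇔φ<+ : x <φ y ⇔ φ x < x + y
<φ⇔φ<+ {x} {y} = mk⇔
  (λ { (mk<φ lt) → mkφ< (subst₂ _<_ (sym lhs) (sym rhs) (+-monoʳ-< (x * x + x * y) lt)) })
  (λ { (mkφ< lt) → mk<φ (+-cancelˡ-< (x * x + x * y) _ _ (subst₂ _<_ lhs rhs lt)) })
  where
  lhs : (x + y) * x + x * x ≡ (x * x + x * y) + x * x
  lhs = solve (x ∷ y ∷ [])
  rhs : (x + y) * (x + y) ≡ (x * x + x * y) + (x * y + y * y)
  rhs = solve (x ∷ y ∷ [])

φ<⇔+<φ : φ y < x ⇔ x + y <φ x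
φ<⇔+<φ {y} {x} = mk⇔
  (λ { (mkφ< lt) → mk<φ (subst₂ _<_ (sym lhs) (sym rhs) (+-monoʳ-< (x * x + x * y) lt)) })
  (λ { (mk<φ lt) → mkφ< (+-cancelˡ-< (x * x + x * y) _ _ (subst₂ _<_ lhs rhs lt)) })
  where
  lhs : (x + y) * (x + y) ≡ (x * x + x * y) + (x * y + y * y)
  lhs = solve (x ∷ y ∷ [])
  rhs : (x + y) * x + x * x ≡ (x * x + x * y) + x * x
  rhs = solve (x ∷ y ∷ [])

φn<1+n+n : ∀ n → φ n < suc (n + n)
φn<1+n+n n = mkφ< (begin-strict
  suc (n + n) * n + n * n                         <⟨ m<m+n _ z<s ⟩
  suc (n + n) * n + n * n + suc (n * n + 3 * n)   ≡⟨ solve (n ∷ []) ⟩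
  suc (n + n) * suc (n + n)                       ∎)
  where open ≤-Reasoning

≤φ⇒≤+ : x ≤φ y → x ≤ y + y
≤φ⇒≤+ {x} {y} x≤φy = ≮⇒≥ (λ 2y<x → ≤φ⇒¬φ< x≤φy (φ<-≤-trans (φn<1+n+n y) 2y<x))

≤φ-monoʳ : x ≤φ y → y ≤ y′ → x ≤φ y′
≤φ-monoʳ {x} (mk≤φ le) y≤y′ = mk≤φ (≤-trans le (+-mono-≤ (*-monoʳ-≤ x y≤y′) (*-mono-≤ y≤y′ y≤y′)))

≤φ-suc : x ≤φ y → suc x ≤φ suc y
≤φ-suc {x} {y} x≤φy@(mk≤φ le) = mk≤φ (begin
  suc x * suc x                                   ≡⟨ solve (x ∷ []) ⟩
  x * x + (x + x + 1)                             ≤⟨ +-mono-≤ le (+-monoˡ-≤ 1 (+-monoʳ-≤ x (≤φ⇒≤+ x≤φy))) ⟩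
  (x * y + y * y) + (x + (y + y) + 1)             ≤⟨ m≤m+n _ (y + 1) ⟩
  (x * y + y * y) + (x + (y + y) + 1) + (y + 1)   ≡⟨ solve (x ∷ y ∷ []) ⟩
  suc x * suc y + suc y * suc y                   ∎)
  where open ≤-Reasoning

-- Descent (x , y) ↦ (y , x ∸ y): a solution with y > 0 yields a smaller one.
φ-irrational : ∀ x y → x * x ≡ x * y + y * y → y ≡ 0
φ-irrational x zero    _ = refl
φ-irrational x (suc y) e = ⊥-elim (descent x (suc y) (<-wellFounded (suc y)) z<s e)
  where
  x≤y⇒x*x<x*y+y*y : ∀ {x y} → x ≤ y → 0 < y → x * x < x * y + y * y
  x≤y⇒x*x<x*y+y*y {x} {y} x≤y y>0 = ≤-<-trans (*-monoʳ-≤ x x≤y) (m<m+n (x * y) (*-mono-< y>0 y>0))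

  descent : ∀ x y → Acc _<_ y → 0 < y → x * x ≡ x * y + y * y → ⊥
  descent x y (acc rs) y>0 e with m≤n⇒∃[o]m+o≡n (<⇒≤ (≰⇒> {x} {y} λ x≤y → <-irrefl e (x≤y⇒x*x<x*y+y*y x≤y y>0)))
  ... | z , refl = next z e′
    where
    e′ : y * y ≡ y * z + z * z
    e′ = +-cancelˡ-≡ (y * y + y * z) _ _ (begin
      (y * y + y * z) + y * y            ≡⟨ solve (y ∷ z ∷ []) ⟩
      (y + z) * y + y * y                ≡⟨ sym e ⟩
      (y + z) * (y + z)                  ≡⟨ solve (y ∷ z ∷ []) ⟩
      (y * y + y * z) + (y * z + z * z)  ∎)
      where open ≡-Reasoning
    next : ∀ z → y * y ≡ y * z + z * z → ⊥
    next zero    e′ = <-irrefl (sym (trans e′ (trans (+-identityʳ (y * 0)) (*-zeroʳ y)))) (*-mono-< y>0 y>0)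
    next (suc z) e′ = descent y (suc z) (rs z<y) z<s e′
      where
      z<y : suc z < y
      z<y = ≰⇒> λ y≤z → <-irrefl e′ (x≤y⇒x*x<x*y+y*y y≤z z<s)

φ-cmp : ∀ x → 0 < y → x <φ y ⊎ φ y < x
φ-cmp {y} x y>0 with <-cmp (x * x) (x * y + y * y)
... | tri< lt _ _ = inj₁ (mk<φ lt)
... | tri≈ _ eq _ = ⊥-elim (<-irrefl (sym (φ-irrational x y eq)) y>0)
... | tri> _ _ gt = inj₂ (mkφ< gt)

≤φ⇒<φ : 0 < y → x ≤φ y → x <φ y
≤φ⇒<φ {x = x} y>0 x≤φy with φ-cmp x y>0
... | inj₁ x<φy = x<φy
... | inj₂ φy<x = ⊥-elim (≤φ⇒¬φ< x≤φy φy<x)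

crossing : ∀ {Q : ℕ → Set} → Decidable Q → ¬ Q 0 → ∀ k → Q k → ∃[ m ] ¬ Q m × Q (suc m)
crossing Q? ¬Q0 zero    Qk = ⊥-elim (¬Q0 Qk)
crossing Q? ¬Q0 (suc k) Qk with Q? k
... | yes Qk′ = crossing Q? ¬Q0 k Qk′
... | no ¬Qk  = k , ¬Qk , Qk

-- The floor ⌊φ n⌋

infix 4 ⌊φ_⌋≡_

record ⌊φ_⌋≡_ (n m : ℕ) : Set where
  constructor mk⌊φ⌋
  field
    lower : m ≤φ n
    upper : φ n < suc m

open ⌊φ_⌋≡_

⌊φ⌋-greatest : x ≤φ n → ⌊φ n ⌋≡ m → x ≤ m
⌊φ⌋-greatest x≤φn f = ≮⇒≥ λ m<x → ≤φ⇒¬φ< x≤φn (φ<-≤-trans (upper f) m<x)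

⌊φ⌋-unique : ⌊φ n ⌋≡ m → ⌊φ n ⌋≡ m′ → m ≡ m′
⌊φ⌋-unique f f′ = ≤-antisym (⌊φ⌋-greatest (lower f) f′) (⌊φ⌋-greatest (lower f′) f)

-- Opaque: only its type matters, and with-abstraction over an unfolded witness is very slow.
opaque
  ⌊φ⌋-exists : ∀ n → ∃[ m ] ⌊φ n ⌋≡ m
  ⌊φ⌋-exists n with crossing (φ n <?_) (λ { (mkφ< ()) }) (suc (n + n)) (φn<1+n+n n)
  ... | m , ¬φn<m , φn<1+m = m , mk⌊φ⌋ (¬φ<⇒≤φ ¬φn<m) φn<1+m

⌊φ0⌋≡0 : ⌊φ 0 ⌋≡ 0
⌊φ0⌋≡0 = mk⌊φ⌋ (mk≤φ z≤n) (mkφ< z<s)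

n≤⌊φn⌋ : ⌊φ n ⌋≡ m → n ≤ m
n≤⌊φn⌋ = ⌊φ⌋-greatest (≤⇒≤φ ≤-refl)

⌊φn⌋≤n+n : ⌊φ n ⌋≡ m → m ≤ n + n
⌊φn⌋≤n+n f = ≤φ⇒≤+ (lower f)

⌊φn⌋<φn : 0 < n → ⌊φ n ⌋≡ m → m <φ n
⌊φn⌋<φn n>0 f = ≤φ⇒<φ n>0 (lower f)

⌊φ⌋-mono-< : n < n′ → ⌊φ n ⌋≡ m → ⌊φ n′ ⌋≡ m′ → m < m′
⌊φ⌋-mono-< n<n′ f f′ = ⌊φ⌋-greatest (≤φ-monoʳ (≤φ-suc (lower f)) n<n′) f′

⌊φ⌋-injective : ⌊φ n ⌋≡ m → ⌊φ n′ ⌋≡ m → n ≡ n′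
⌊φ⌋-injective f f′ = ≤-antisym
  (≮⇒≥ λ n′<n → <-irrefl refl (⌊φ⌋-mono-< n′<n f′ f))
  (≮⇒≥ λ n<n′ → <-irrefl refl (⌊φ⌋-mono-< n<n′ f f′))

⌊φ⌋+id-injective : ⌊φ n ⌋≡ m → ⌊φ n′ ⌋≡ m′ → m + n ≡ m′ + n′ → n ≡ n′
⌊φ⌋+id-injective f f′ eq = ≤-antisym
  (≮⇒≥ λ n′<n → <-irrefl (sym eq) (+-mono-< (⌊φ⌋-mono-< n′<n f′ f) n′<n))
  (≮⇒≥ λ n<n′ → <-irrefl eq (+-mono-< (⌊φ⌋-mono-< n<n′ f f′) n<n′))

⌊φ⌋≡0⇒≡0 : ⌊φ n ⌋≡ 0 → n ≡ 0
⌊φ⌋≡0⇒≡0 f = ⌊φ⌋-injective f ⌊φ0⌋≡0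

-- Since φ − 1 = 1/φ, x < φ y ⇔ φ x < x + y. Applied to N < φ m < N + 1 and c < φ n < c + 1,
-- where N = c + n, this gives N + c < φ N < N + m and N + 1 + m < φ (N + 1) < N + 1 + c + 1,
-- hence c < m < c + 1.
⌊φ⌋-disjoint : ⌊φ m ⌋≡ c + n → ⌊φ n ⌋≡ c → n ≡ 0
⌊φ⌋-disjoint {zero}  {c} f _ = m+n≡0⇒n≡0 c (⌊φ⌋-unique f ⌊φ0⌋≡0)
⌊φ⌋-disjoint {suc _} {n = zero} _ _ = refl
⌊φ⌋-disjoint {m@(suc _)} {c} {n@(suc _)} f g = ⊥-elim (<⇒≱ c<m (s≤s⁻¹ m<1+c))
  where
  c<m : c < m
  c<m = +-cancelˡ-< (c + n) c m (<φ-φ<-trans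
    (to φ<⇔+<φ (to <φ⇔φ<+ (⌊φn⌋<φn z<s g)))
    (to <φ⇔φ<+ (⌊φn⌋<φn z<s f)))
  m<1+c : m < suc c
  m<1+c = +-cancelˡ-< (suc (c + n)) m (suc c) (<φ-φ<-trans
    (to φ<⇔+<φ (upper f))
    (to <φ⇔φ<+ (to φ<⇔+<φ (upper g))))

-- With ⌊φ x⌋ = x + c and x = c + n, comparing φ (x + 1) with x + c + 2 decides
-- whether x = ⌊φ (c + 1)⌋ or c = ⌊φ n⌋.
⌊φ⌋-complement⁺ : 0 < x → (∃[ m ] ⌊φ m ⌋≡ x) ⊎ (∃[ n ] ∃[ c ] ⌊φ n ⌋≡ c × x ≡ c + n × 0 < n)
⌊φ⌋-complement⁺ {x} x>0 with ⌊φ⌋-exists x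
... | k , fk with m≤n⇒∃[o]m+o≡n (n≤⌊φn⌋ fk)
... | c , refl with m≤n⇒∃[o]m+o≡n (+-cancelˡ-≤ x c x (⌊φn⌋≤n+n fk))
... | n , c+n≡x with φ-cmp (suc x + suc c) z<s
... | inj₁ lt = inj₁ (suc c , mk⌊φ⌋ x≤φ1+c (from φ<⇔+<φ lt))
  where
  x≤φ1+c : x ≤φ suc c
  x≤φ1+c = <φ⇒≤φ (from <φ⇔φ<+ (subst (φ x <_) (sym (+-suc x c)) (upper fk)))
... | inj₂ gt = inj₂ (n , c , mk⌊φ⌋ (<φ⇒≤φ c<φn) φn<1+c , sym c+n≡x , n>0)
  where
  c<φn : c <φ n
  c<φn = from <φ⇔φ<+ (subst (φ c <_) (sym c+n≡x) (from φ<⇔+<φ (⌊φn⌋<φn x>0 fk)))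
  φn<1+c : φ n < suc c
  φn<1+c = from φ<⇔+<φ (subst (_<φ suc c) (cong suc (sym c+n≡x)) (from <φ⇔φ<+ gt))
  n>0 : 0 < n
  n>0 = n≢0⇒n>0 λ { refl → <-irrefl refl (φ<⇒> (from φ<⇔+<φ
    (subst (λ c → x + c <φ x) (trans (sym (+-identityʳ c)) c+n≡x) (⌊φn⌋<φn x>0 fk)))) }

⌊φ⌋-complement : ∀ x → (∃[ m ] ⌊φ m ⌋≡ x) ⊎ (∃[ n ] ∃[ c ] ⌊φ n ⌋≡ c × x ≡ c + n × 0 < n)
⌊φ⌋-complement zero    = inj₁ (0 , ⌊φ0⌋≡0)
⌊φ⌋-complement (suc _) = ⌊φ⌋-complement⁺ z<s

WythoffPair : Pos → Set
WythoffPair (a , b) = ∃[ n ] ⌊φ n ⌋≡ a × b ≡ a + n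

Wythoff : Pos → Set
Wythoff p = WythoffPair p ⊎ WythoffPair (swap p)

Wythoff-swap : Wythoff (a , b) → Wythoff (b , a)
Wythoff-swap = Sum.swap

Wythoff-ordered : Wythoff (x , y) → x ≤ y → WythoffPair (x , y)
Wythoff-ordered (inj₁ w) _ = w
Wythoff-ordered {y = y} (inj₂ (n , f , refl)) y+n≤y
  with n≤0⇒n≡0 (+-cancelˡ-≤ y n 0 (subst (y + n ≤_) (sym (+-identityʳ y)) y+n≤y))
... | refl with ⌊φ⌋-unique ⌊φ0⌋≡0 f
... | refl = 0 , ⌊φ0⌋≡0 , refl

Wythoff-functional : Wythoff (x , y) → Wythoff (x , y′) → y ≡ y′
Wythoff-functional (inj₁ (n , f , refl)) (inj₁ (n′ , f′ , refl)) with ⌊φ⌋-injective f f′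
... | refl = refl
Wythoff-functional (inj₁ (n , f , refl)) (inj₂ (n′ , f′ , refl)) with ⌊φ⌋-disjoint f f′
... | refl with ⌊φ⌋-unique ⌊φ0⌋≡0 f′
... | refl with ⌊φ⌋≡0⇒≡0 f
... | refl = refl
Wythoff-functional (inj₂ (n , f , refl)) (inj₁ (n′ , f′ , refl)) with ⌊φ⌋-disjoint f′ f
... | refl with ⌊φ⌋-unique ⌊φ0⌋≡0 f
... | refl with ⌊φ⌋≡0⇒≡0 f′
... | refl = refl
Wythoff-functional (inj₂ (n , f , x≡y+n)) (inj₂ (n′ , f′ , x≡y′+n′))
  with ⌊φ⌋+id-injective f f′ (trans (sym x≡y+n) x≡y′+n′)
... | refl = ⌊φ⌋-unique f f′

WMove-swap : WMove (a , b) (c , d) → WMove (b , a) (d , c)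
WMove-swap takeL = takeR
WMove-swap takeR = takeL
WMove-swap takeB = takeB

takeR-< : b < c → WMove (a , c) (a , b)
takeR-< {b} {a = a} b<c with m≤n⇒∃[o]m+o≡n b<c
... | s , refl = subst (λ c → WMove (a , c) (a , b)) (+-suc b s) takeR

takeB-< : a < c → WMove (c , c + d) (a , a + d)
takeB-< {a} {d = d} a<c with m≤n⇒∃[o]m+o≡n a<c
... | s , refl = subst (λ p → WMove p (a , a + d)) (cong₂ _,_ (+-suc a s) shift) takeB
  where
  shift : a + d + suc s ≡ suc a + s + d
  shift = solve (a ∷ d ∷ s ∷ [])

Wythoff-independent-diagonal : a ≤ b → Wythoff (a + suc k , b + suc k) → Wythoff (a , b) → ⊥
Wythoff-independent-diagonal {a} {b} {k} a≤b w w′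
  with Wythoff-ordered w (+-monoˡ-≤ (suc k) a≤b) | Wythoff-ordered w′ a≤b
... | n , f , e | n′ , f′ , refl with +-cancelˡ-≡ (a + suc k) n′ n (trans shift e)
  where
  shift : a + suc k + n′ ≡ a + n′ + suc k
  shift = solve (a ∷ k ∷ n′ ∷ [])
... | refl = m+1+n≢m a (⌊φ⌋-unique f f′)

Wythoff-independent-extra : l < k → a + k ≤ b + l → Wythoff (a + k , b + l) → Wythoff (a , b) → ⊥
Wythoff-independent-extra {l} {k} {a} {b} l<k a+k≤b+l w w′ with a ≤? b
... | no a≰b = <⇒≱ (+-mono-< (≰⇒> a≰b) l<k) a+k≤b+l
... | yes a≤b with Wythoff-ordered w a+k≤b+l | Wythoff-ordered w′ a≤b
... | n , f , e | n′ , f′ , refl = <⇒≱ (⌊φ⌋-mono-< n<n′ f f′) (m≤m+n a k)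
  where
  n′+l≡n+k : n′ + l ≡ n + k
  n′+l≡n+k = +-cancelˡ-≡ a _ _ (begin
    a + (n′ + l)   ≡⟨ solve (a ∷ n′ ∷ l ∷ []) ⟩
    a + n′ + l     ≡⟨ e ⟩
    a + k + n      ≡⟨ solve (a ∷ k ∷ n ∷ []) ⟩
    a + (n + k)    ∎)
    where open ≡-Reasoning
  n<n′ : n < n′
  n<n′ = ≰⇒> λ n′≤n → <-irrefl n′+l≡n+k (+-mono-≤-< n′≤n l<k)

Wythoff-independent : EMove p q → Wythoff p → Wythoff q → ⊥
Wythoff-independent (wyt (takeL {a})) w w′ = m+1+n≢m a (Wythoff-functional (Wythoff-swap w) (Wythoff-swap w′))
Wythoff-independent (wyt (takeR {b = b})) w w′ = m+1+n≢m b (Wythoff-functional w w′)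
Wythoff-independent (wyt (takeB {a} {b})) w w′ with ≤-total a b
... | inj₁ a≤b = Wythoff-independent-diagonal a≤b w w′
... | inj₂ b≤a = Wythoff-independent-diagonal b≤a (Wythoff-swap w) (Wythoff-swap w′)
Wythoff-independent (extraL l<k a+k≤b+l) w w′ = Wythoff-independent-extra l<k a+k≤b+l w w′
Wythoff-independent (extraR l<k b+k≤a+l) w w′ =
  Wythoff-independent-extra l<k b+k≤a+l (Wythoff-swap w) (Wythoff-swap w′)

Wythoff-absorbing-ordered : x ≤ y → Wythoff (x , y) ⊎ ∃[ q ] WMove (x , y) q × Wythoff q
Wythoff-absorbing-ordered {x} {y} x≤y with ⌊φ⌋-complement x
... | inj₂ (n , c , f , refl , n>0) =
  inj₂ ((c + n , c) , takeR-< (<-≤-trans (m<m+n c n>0) x≤y) , inj₂ (n , f , refl))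
... | inj₁ (n , f) with <-cmp y (x + n)
... | tri≈ _ y≡x+n _ = inj₁ (inj₁ (n , f , y≡x+n))
... | tri> _ _ y>x+n = inj₂ ((x , x + n) , takeR-< y>x+n , inj₁ (n , f , refl))
... | tri< y<x+n _ _ with m≤n⇒∃[o]m+o≡n x≤y
... | d , refl with ⌊φ⌋-exists d
... | m , f′ = inj₂ ((m , m + d) , takeB-< (⌊φ⌋-mono-< (+-cancelˡ-< x d n y<x+n) f′ f) , inj₁ (d , f′ , refl))

Wythoff-absorbing : ∀ p → Wythoff p ⊎ ∃[ q ] WMove p q × Wythoff q
Wythoff-absorbing (x , y) with x ≤? y
... | yes x≤y = Wythoff-absorbing-ordered x≤y
... | no x≰y with Wythoff-absorbing-ordered (<⇒≤ (≰⇒> x≰y))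
... | inj₁ w = inj₁ (Wythoff-swap w)
... | inj₂ ((c , d) , mv , w) = inj₂ ((d , c) , WMove-swap mv , Wythoff-swap w)

-- Kernels of terminating games

size : Pos → ℕ
size (a , b) = a + b

WMove-shrinks : WMove p q → size q < size p
WMove-shrinks (takeL {a} {b} {k}) = +-monoˡ-< b (m<m+n a {suc k} z<s)
WMove-shrinks (takeR {a} {b} {k}) = +-monoʳ-< a (m<m+n b {suc k} z<s)
WMove-shrinks (takeB {a} {b} {k}) = +-mono-< (m<m+n a {suc k} z<s) (m<m+n b {suc k} z<s)

EMove-shrinks : EMove p q → size q < size p
EMove-shrinks (wyt mv) = WMove-shrinks mv
EMove-shrinks (extraL {a} {b} {k} {l} l<k _) = +-mono-<-≤ (m<m+n a {k} (≤-<-trans z≤n l<k)) (m≤m+n b l)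
EMove-shrinks (extraR {a} {b} {k} {l} l<k _) = +-mono-≤-< (m≤m+n a l) (m<m+n b {k} (≤-<-trans z≤n l<k))

P⇒¬N : ∀ {Move} → P Move p → ¬ N Move p
P⇒¬N (allToN toN) (toP q mv Pq) = P⇒¬N Pq (toN q mv)

module _ {Move : Pos → Pos → Set} {K : Pos → Set}
         (shrinks : ∀ {p q} → Move p q → size q < size p)
         (independent : ∀ {p q} → Move p q → K p → K q → ⊥)
         (absorbing : ∀ p → K p ⊎ ∃[ q ] Move p q × K q)
         where

  kernel⇒P : ∀ p → Acc _<_ (size p) → K p → P Move p
  kernel⇒P p (acc rs) Kp = allToN λ q p→q → reply p→q (absorbing q)
    where
    reply : Move p q → K q ⊎ ∃[ r ] Move q r × K r → N Move q
    reply p→q (inj₁ Kq) = ⊥-elim (independent p→q Kp Kq)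
    reply p→q (inj₂ (r , q→r , Kr)) =
      toP r q→r (kernel⇒P r (rs (<-trans (shrinks q→r) (shrinks p→q))) Kr)

  P⇔kernel : ∀ p → P Move p ⇔ K p
  P⇔kernel p = mk⇔ P⇒K (kernel⇒P p (<-wellFounded (size p)))
    where
    P⇒K : P Move p → K p
    P⇒K Pp with absorbing p
    ... | inj₁ Kp = Kp
    ... | inj₂ (q , p→q , Kq) = ⊥-elim (P⇒¬N Pp (toP q p→q (kernel⇒P q (<-wellFounded (size q)) Kq)))

n^2≡n*n : ∀ n → n ^ 2 ≡ n * n
n^2≡n*n n = cong (n *_) (*-identityʳ n)

square-identity : n + t ≡ 2 * x → t * t + 4 * (x * n + n * n) ≡ 4 * (x * x) + 5 * (n * n)
square-identity {n} {t} {x} n+t≡2x = begin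
  t * t + 4 * (x * n + n * n)           ≡⟨ solve (t ∷ x ∷ n ∷ []) ⟩
  t * t + 2 * n * (2 * x) + 4 * (n * n) ≡⟨ cong (λ u → t * t + 2 * n * u + 4 * (n * n)) (sym n+t≡2x) ⟩
  t * t + 2 * n * (n + t) + 4 * (n * n) ≡⟨ solve (t ∷ n ∷ []) ⟩
  (n + t) * (n + t) + 5 * (n * n)       ≡⟨ cong (λ u → u * u + 5 * (n * n)) n+t≡2x ⟩
  2 * x * (2 * x) + 5 * (n * n)         ≡⟨ solve (x ∷ n ∷ []) ⟩
  4 * (x * x) + 5 * (n * n)             ∎
  where open ≡-Reasoning

-- 4 (x² − x n − n²) = (2x − n)² − 5 n², and when 2 x < n both sides hold trivially.
≤φ⇔square : x ≤φ n ⇔ (2 * x ∸ n) ^ 2 ≤ 5 * n ^ 2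
≤φ⇔square {x} {n} with n ≤? 2 * x
... | no n≰2x rewrite m≤n⇒m∸n≡0 (<⇒≤ (≰⇒> n≰2x)) =
  mk⇔ (λ _ → z≤n) (λ _ → ≤⇒≤φ (≤-trans (m≤m+n x (x + 0)) (<⇒≤ (≰⇒> n≰2x))))
... | yes n≤2x with m≤n⇒∃[o]m+o≡n n≤2x
... | t , n+t≡2x rewrite sym n+t≡2x | m+n∸m≡n n t | n^2≡n*n t | n^2≡n*n n = mk⇔ to′ from′
  where
  Q = 4 * (x * n + n * n)
  to′ : x ≤φ n → t * t ≤ 5 * (n * n)
  to′ (mk≤φ le) = +-cancelʳ-≤ Q _ _ (begin
    t * t + Q                   ≡⟨ square-identity {n} {t} {x} n+t≡2x ⟩
    4 * (x * x) + 5 * (n * n)   ≤⟨ +-monoˡ-≤ (5 * (n * n)) (*-monoʳ-≤ 4 le) ⟩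
    Q + 5 * (n * n)             ≡⟨ +-comm Q _ ⟩
    5 * (n * n) + Q             ∎)
    where open ≤-Reasoning
  from′ : t * t ≤ 5 * (n * n) → x ≤φ n
  from′ le = mk≤φ (*-cancelˡ-≤ 4 (+-cancelʳ-≤ (5 * (n * n)) _ _ (begin
    4 * (x * x) + 5 * (n * n)   ≡⟨ square-identity {n} {t} {x} n+t≡2x ⟨
    t * t + Q                   ≤⟨ +-monoˡ-≤ Q le ⟩
    5 * (n * n) + Q             ≡⟨ +-comm _ Q ⟩
    Q + 5 * (n * n)             ∎)))
    where open ≤-Reasoning

φ<⇔square : (φ n < x) ⇔ 5 * n ^ 2 < (2 * x ∸ n) ^ 2
φ<⇔square {n} {x} = mk⇔
  (λ φn<x → ≰⇒> λ square≤ → ≤φ⇒¬φ< (from ≤φ⇔square square≤) φn<x)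
  (λ square> → mkφ< (≰⇒> λ le → <⇒≱ square> (to (≤φ⇔square {x} {n}) (mk≤φ le))))

IsFloorPhiMul⇔⌊φ⌋≡ : IsFloorPhiMul n m ⇔ ⌊φ n ⌋≡ m
IsFloorPhiMul⇔⌊φ⌋≡ {n} {m} = mk⇔
  (λ (l , u) → mk⌊φ⌋ (from (≤φ⇔square {m} {n}) l) (from (φ<⇔square {n} {suc m}) u))
  (λ f → to ≤φ⇔square (lower f) , to φ<⇔square (upper f))

Wythoff⇔WythoffSet : ∀ p → Wythoff p ⇔ WythoffSet p
Wythoff⇔WythoffSet (a , b) = mk⇔ toSet fromSet
  where
  toSet : Wythoff (a , b) → WythoffSet (a , b)
  toSet (inj₁ (n , f , e)) = n , a , from IsFloorPhiMul⇔⌊φ⌋≡ f , inj₁ (refl , e)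
  toSet (inj₂ (n , f , e)) = n , b , from IsFloorPhiMul⇔⌊φ⌋≡ f , inj₂ (refl , e)
  fromSet : WythoffSet (a , b) → Wythoff (a , b)
  fromSet (n , m , f , inj₁ (refl , e)) = inj₁ (n , to IsFloorPhiMul⇔⌊φ⌋≡ f , e)
  fromSet (n , m , f , inj₂ (refl , e)) = inj₂ (n , to IsFloorPhiMul⇔⌊φ⌋≡ f , e)

P-WMove⇔Wythoff : ∀ p → P WMove p ⇔ Wythoff p
P-WMove⇔Wythoff = P⇔kernel WMove-shrinks (λ mv → Wythoff-independent (wyt mv)) Wythoff-absorbing

P-EMove⇔Wythoff : ∀ p → P EMove p ⇔ Wythoff p
P-EMove⇔Wythoff = P⇔kernel EMove-shrinks Wythoff-independent EMove-absorbing
  where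
  EMove-absorbing : ∀ p → Wythoff p ⊎ ∃[ q ] EMove p q × Wythoff q
  EMove-absorbing p = Sum.map₂ (λ (q , mv , w) → q , wyt mv , w) (Wythoff-absorbing p)

theorem3p1 : (∀ p → P EMove p ⇔ P WMove p) × (∀ p → P WMove p ⇔ WythoffSet p)
theorem3p1 =
  (λ p → ⇔-sym (P-WMove⇔Wythoff p) ⇔-∘ P-EMove⇔Wythoff p) ,
  (λ p → Wythoff⇔WythoffSet p ⇔-∘ P-WMove⇔Wythoff p)
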